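{- Let $p_1,p_2,q_1,q_2$ be pairwise distinct primes, and let $M\le N\le U$ and $e_\alpha$ ($\alpha<\omega$) be as in the context. If $f:N\to N$ is a group homomorphism with $f(e_\alpha)=e_\alpha$ for all $\alpha<\omega$, then $f=\operatorname{id}_N$.
   Context: $U:=\prod_{\alpha<\omega}\mathbb{Q}e_\alpha$ (so $e_\alpha$ is the element with $1$ in coordinate $\alpha$ and $0$ elsewhere), $\mathbb{Z}[1/p,1/q]$ denotes the subring of $\mathbb{Q}$ generated by $1/p,1/q$, and $M:=\bigoplus_{\alpha<\omega}\mathbb{Z}[1/p_1,1/p_2]e_\alpha\le U$. For each $\alpha<\omega$ fix integers $c_\alpha,d_\alpha$ with $c_\alpha q_1^\alpha+d_\alpha q_2^\alpha=1$, and set $y_\alpha:=\sum_{k\ge\alpha}c_kq_1^{k-\alpha}e_k$ and $z_\alpha:=\sum_{k\ge\alpha}d_kq_2^{k-\alpha}e_k$. Let $N$ be the subgroup of $U$ generated by $M$ together with $\mathbb{Z}[1/p_2]y_\alpha$ and $\mathbb{Z}[1/p_2]z_\alpha$ for all $\alpha<\omega$. -}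

module Defs where

open import Data.Nat as ℕ using (ℕ; _<ᵇ_; _∸_)
open import Data.Integer as ℤ using (ℤ; +_)
open import Data.Rational as ℚ using (ℚ; 0ℚ; 1ℚ)
open import Data.Bool using (if_then_else_)
open import Data.Product using (Σ; ∃; _×_)
open import Data.Sum using (_⊎_)
open import Relation.Nullary using (does)
open import Relation.Binary.PropositionalEquality using (_≡_)

ℤ→ℚ : ℤ → ℚ
ℤ→ℚ a = a ℚ./ 1

ℕ→ℚ : ℕ → ℚ
ℕ→ℚ n = (+ n) ℚ./ 1

-- U = ∏_{α<ω} ℚ e_α, represented as functions ℕ → ℚ
U : Set
U = ℕ → ℚ

_≈_ : U → U → Set
x ≈ y = ∀ k → x k ≡ y k
infix 4 _≈_

0U : U
0U _ = 0ℚ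

_+U_ : U → U → U
(x +U y) k = x k ℚ.+ y k

-U_ : U → U
(-U x) k = ℚ.- (x k)

_·_ : ℚ → U → U
(r · x) k = r ℚ.* x k

e : ℕ → U
e α k = if does (k ℕ.≟ α) then 1ℚ else 0ℚ

InZ[1/p,1/q] : ℕ → ℕ → ℚ → Set
InZ[1/p,1/q] p q r = ∃ λ (a : ℤ) → ∃ λ (m : ℕ) → ∃ λ (n : ℕ) →
  r ℚ.* ℕ→ℚ (p ℕ.^ m ℕ.* q ℕ.^ n) ≡ ℤ→ℚ a

InZ[1/p] : ℕ → ℚ → Set
InZ[1/p] p r = ∃ λ (a : ℤ) → ∃ λ (m : ℕ) → r ℚ.* ℕ→ℚ (p ℕ.^ m) ≡ ℤ→ℚ a

data ⟨_⟩ (G : U → Set) : U → Set where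
  gen  : ∀ {x} → G x → ⟨ G ⟩ x
  zero : ⟨ G ⟩ 0U
  sub  : ∀ {x y} → ⟨ G ⟩ x → ⟨ G ⟩ y → ⟨ G ⟩ (x +U (-U y))
  resp : ∀ {x y} → x ≈ y → ⟨ G ⟩ x → ⟨ G ⟩ y

-- M = ⊕_α ℤ[1/p₁,1/p₂] e_α
M-gens : ℕ → ℕ → U → Set
M-gens p₁ p₂ x = ∃ λ (α : ℕ) → ∃ λ (r : ℚ) → InZ[1/p,1/q] p₁ p₂ r × (x ≈ r · e α)

InM : ℕ → ℕ → U → Set
InM p₁ p₂ = ⟨ M-gens p₁ p₂ ⟩

-- y_α = Σ_{k≥α} c_k q₁^{k-α} e_k ,  z_α = Σ_{k≥α} d_k q₂^{k-α} e_k
-- (c gives the sequence c_k, q the prime q₁ resp. d, q₂)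
tailSeq : (ℕ → ℤ) → ℕ → ℕ → U
tailSeq c q α k = if k <ᵇ α then 0ℚ else ℤ→ℚ (c k ℤ.* (+ (q ℕ.^ (k ∸ α))))

-- N = ⟨ M , ℤ[1/p₂] y_α , ℤ[1/p₂] z_α : α < ω ⟩
N-gens : (p₁ p₂ q₁ q₂ : ℕ) (c d : ℕ → ℤ) → U → Set
N-gens p₁ p₂ q₁ q₂ c d x =
  InM p₁ p₂ x
  ⊎ (∃ λ (α : ℕ) → ∃ λ (r : ℚ) → InZ[1/p] p₂ r × (x ≈ r · tailSeq c q₁ α))
  ⊎ (∃ λ (α : ℕ) → ∃ λ (r : ℚ) → InZ[1/p] p₂ r × (x ≈ r · tailSeq d q₂ α))

InN : (p₁ p₂ q₁ q₂ : ℕ) (c d : ℕ → ℤ) → U → Set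
InN p₁ p₂ q₁ q₂ c d = ⟨ N-gens p₁ p₂ q₁ q₂ c d ⟩

-- a group homomorphism f : N → N, N = {x ∈ U | InN x} with equality ≈.
-- f is given on elements together with membership proofs; it must be
-- well defined (independent of the proof, respects ≈), land in N, and be additive.
record EndoHom (InS : U → Set) : Set where
  field
    f       : (x : U) → InS x → U
    f-in    : ∀ x (h : InS x) → InS (f x h)
    f-cong  : ∀ x y (hx : InS x) (hy : InS y) → x ≈ y → f x hx ≈ f y hy
    f-add   : ∀ x y (hx : InS x) (hy : InS y) (hxy : InS (x +U y)) →
              f (x +U y) hxy ≈ (f x hx +U f y hy)

{-# OPTIONS --safe #-}
module Submission where

-- Since U is torsion-free, an element of N that is a rational multiple of a fixed element is
-- itself fixed; this handles M and reduces the other generators to y_α and z_α. From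
-- y_α = c_α e_α + q₁ y_{α+1}, the defect f(y_α) − y_α is q₁ times the defect at α + 1, so
-- it is divisible in N by every power of q₁. The coordinates of elements of N lie in
-- ℤ[1/p₁,1/p₂] ⊆ ℤ₍q₁₎, where only 0 is divisible by every power of q₁, so the defect vanishes.
-- The same argument works for z_α with q₂.

open import Defs
open import Data.Nat using (ℕ)
open import Data.Integer using (ℤ; _+_; _*_; +_)
open import Data.Nat.Primality using (Prime)
open import Relation.Binary.PropositionalEquality using (_≡_; _≢_)
import Data.Nat as ℕ

open import Data.Nat using (zero; suc; _^_; _<_; z≤n; s≤s)
import Data.Nat.Properties as ℕP
open import Data.Nat.Divisibility using (_∣_; divides; ∣-trans; >⇒∤)
open import Data.Nat.Coprimality as Coprimality using (Coprime; coprime-divisor)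
open import Data.Nat.Primality using (prime⇒irreducible; prime⇒nonTrivial)
import Data.Integer as ℤ
open import Data.Integer using (-[1+_]; +[1+_])
import Data.Integer.Properties as ℤP
import Algebra.Properties.CommutativeSemigroup ℤP.*-commutativeSemigroup as ℤ*
open import Data.Rational as ℚ using (ℚ; 0ℚ; 1ℚ; mkℚ; 1/_)
import Data.Rational.Properties as ℚP
import Data.Rational.Unnormalised as ℚᵘ
open import Data.Rational.Solver using (module +-*-Solver)
open +-*-Solver
open import Data.Bool using (true; false; if_then_else_)
open import Data.Product using (∃; _×_; _,_; proj₁; proj₂)
open import Data.Sum using (inj₁; inj₂)
open import Data.Empty using (⊥-elim)
open import Function using (_∘_)
open import Relation.Nullary using (does; contradiction)
open import Relation.Binary.PropositionalEquality
  using (refl; sym; trans; cong; cong₂; subst; module ≡-Reasoning)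

-- On fractions with denominator 1, ℚ's _+_, _*_ and -_ compute definitionally; the
-- homomorphism laws for ℤ→ℚ below all go through this normal form.
ℤ→ℚ-mkℚ : ∀ a → ℤ→ℚ a ≡ mkℚ a 0 (Coprimality.sym (Coprimality.1-coprimeTo ℤ.∣ a ∣))
ℤ→ℚ-mkℚ a = ℚP.↥p/↧p≡p (mkℚ a 0 (Coprimality.sym (Coprimality.1-coprimeTo ℤ.∣ a ∣)))

ℤ→ℚ-injective : ∀ {a b} → ℤ→ℚ a ≡ ℤ→ℚ b → a ≡ b
ℤ→ℚ-injective {a} {b} eq = cong ℚ.↥_ (trans (sym (ℤ→ℚ-mkℚ a)) (trans eq (ℤ→ℚ-mkℚ b)))

ℤ→ℚ-* : ∀ a b → ℤ→ℚ (a * b) ≡ ℤ→ℚ a ℚ.* ℤ→ℚ b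
ℤ→ℚ-* a b = sym (cong₂ ℚ._*_ (ℤ→ℚ-mkℚ a) (ℤ→ℚ-mkℚ b))

ℤ→ℚ-+ : ∀ a b → ℤ→ℚ (a + b) ≡ ℤ→ℚ a ℚ.+ ℤ→ℚ b
ℤ→ℚ-+ a b = trans (cong ℤ→ℚ (sym (cong₂ _+_ (ℤP.*-identityʳ a) (ℤP.*-identityʳ b))))
                  (sym (cong₂ ℚ._+_ (ℤ→ℚ-mkℚ a) (ℤ→ℚ-mkℚ b)))

ℤ→ℚ-neg : ∀ a → ℤ→ℚ (ℤ.- a) ≡ ℚ.- ℤ→ℚ a
ℤ→ℚ-neg (+ zero) = refl
ℤ→ℚ-neg +[1+ n ] = refl
ℤ→ℚ-neg -[1+ n ] = trans (ℤ→ℚ-mkℚ +[1+ n ]) (cong ℚ.-_ (sym (ℤ→ℚ-mkℚ -[1+ n ])))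

ℕ→ℚ-* : ∀ m n → ℕ→ℚ (m ℕ.* n) ≡ ℕ→ℚ m ℚ.* ℕ→ℚ n
ℕ→ℚ-* m n = trans (cong ℤ→ℚ (ℤP.pos-* m n)) (ℤ→ℚ-* (+ m) (+ n))

ℕ→ℚ-suc : ∀ n → ℕ→ℚ (suc n) ≡ 1ℚ ℚ.+ ℕ→ℚ n
ℕ→ℚ-suc n = ℤ→ℚ-+ (+ 1) (+ n)

ℕ→ℚ-≢0 : ∀ {n} → n ≢ 0 → ℕ→ℚ n ≢ 0ℚ
ℕ→ℚ-≢0 n≢0 = n≢0 ∘ ℤP.+-injective ∘ ℤ→ℚ-injective

*-denominator : ∀ r → r ℚ.* ℕ→ℚ (ℚ.↧ₙ r) ≡ ℤ→ℚ (ℚ.↥ r)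
-- r * (1 + d) unfolds to an unnormalised fraction, compared with ↥ r / 1 by cross-multiplication.
*-denominator r@(mkℚ n d _) =
  trans (cong (r ℚ.*_) (ℤ→ℚ-mkℚ (+ suc d)))
        (ℚP.fromℚᵘ-cong {ℚᵘ.mkℚᵘ (n * + suc d) (d ℕ.* 1)} {ℚᵘ.mkℚᵘ n 0} (ℚᵘ.*≡* n[1+d]≡n[1+d*1]))
  where
  n[1+d]≡n[1+d*1] : n * + suc d * + 1 ≡ n * + suc (d ℕ.* 1)
  n[1+d]≡n[1+d*1] = trans (ℤP.*-identityʳ (n * + suc d)) (cong (λ m → n * + suc m) (sym (ℕP.*-identityʳ d)))

*-cancelˡ-≢0 : ∀ r {x y} → r ≢ 0ℚ → r ℚ.* x ≡ r ℚ.* y → x ≡ y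
*-cancelˡ-≢0 r {x} {y} r≢0 rx≡ry = begin
  x                     ≡⟨ sym (ℚP.*-identityˡ x) ⟩
  1ℚ ℚ.* x              ≡⟨ cong (ℚ._* x) (sym (ℚP.*-inverseˡ r)) ⟩
  (1/ r) ℚ.* r ℚ.* x    ≡⟨ ℚP.*-assoc (1/ r) r x ⟩
  (1/ r) ℚ.* (r ℚ.* x)  ≡⟨ cong ((1/ r) ℚ.*_) rx≡ry ⟩
  (1/ r) ℚ.* (r ℚ.* y)  ≡⟨ sym (ℚP.*-assoc (1/ r) r y) ⟩
  (1/ r) ℚ.* r ℚ.* y    ≡⟨ cong (ℚ._* y) (ℚP.*-inverseˡ r) ⟩
  1ℚ ℚ.* y              ≡⟨ ℚP.*-identityˡ y ⟩
  y                     ∎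
  where
  open ≡-Reasoning
  instance
    r-nonZero : ℚ.NonZero r
    r-nonZero = ℚ.≢-nonZero r≢0

x≡y+z⇒y≡x-z : ∀ {x y z} → x ≡ y ℚ.+ z → y ≡ x ℚ.+ ℚ.- z
x≡y+z⇒y≡x-z {x} {y} {z} x≡y+z =
  trans (solve 2 (λ y z → y := (y :+ z) :+ (:- z)) refl y z) (cong (ℚ._+ ℚ.- z) (sym x≡y+z))

x-y≡0⇒x≡y : ∀ {x y} → x ℚ.+ ℚ.- y ≡ 0ℚ → x ≡ y
x-y≡0⇒x≡y {x} {y} x-y≡0 = begin
  x                  ≡⟨ solve 2 (λ x y → x := x :+ (:- y) :+ y) refl x y ⟩
  x ℚ.+ ℚ.- y ℚ.+ y  ≡⟨ cong (ℚ._+ y) x-y≡0 ⟩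
  0ℚ ℚ.+ y           ≡⟨ ℚP.+-identityˡ y ⟩
  y                  ∎
  where open ≡-Reasoning

coprime-*ʳ : ∀ {m a b} → Coprime m a → Coprime m b → Coprime m (a ℕ.* b)
coprime-*ʳ m⊥a m⊥b (i∣m , i∣ab) =
  m⊥b (i∣m , coprime-divisor (λ (j∣i , j∣a) → m⊥a (∣-trans j∣i i∣m , j∣a)) i∣ab)

coprime-^ʳ : ∀ {m a} n → Coprime m a → Coprime m (a ^ n)
coprime-^ʳ {m} zero    _   = Coprimality.sym (Coprimality.1-coprimeTo m)
coprime-^ʳ     (suc n) m⊥a = coprime-*ʳ m⊥a (coprime-^ʳ n m⊥a)

distinct-primes-coprime : ∀ {p q} → Prime p → Prime q → p ≢ q → Coprime p q
distinct-primes-coprime p-prime q-prime p≢q {i} (i∣p , i∣q) with prime⇒irreducible p-prime i∣p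
... | inj₁ i≡1 = i≡1
... | inj₂ refl with prime⇒irreducible q-prime i∣q
...   | inj₁ p≡1 = ⊥-elim (ℕ.nonTrivial⇒≢1 {{prime⇒nonTrivial p-prime}} p≡1)
...   | inj₂ p≡q = ⊥-elim (p≢q p≡q)

coprime⇒≢0 : ∀ {q D} → 1 < q → Coprime q D → D ≢ 0
coprime⇒≢0 1<q q⊥D refl = ℕP.<⇒≢ 1<q (sym (Coprimality.0-coprimeTo-m⇒m≡1 (Coprimality.sym q⊥D)))

n<m^n : ∀ {m} → 1 < m → ∀ n → n < m ^ n
n<m^n 1<m zero    = s≤s z≤n
n<m^n 1<m (suc n) = ℕP.≤-<-trans (n<m^n 1<m n) (ℕP.^-monoʳ-< _ 1<m (ℕP.n<1+n n))

-- Take n = a: q ^ a would divide a, although a < q ^ a.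
divisible-by-all-powers⇒≡0 : ∀ {q a} → 1 < q →
  (∀ n → ∃ λ D → Coprime q D × q ^ n ∣ D ℕ.* a) → a ≡ 0
divisible-by-all-powers⇒≡0 {a = zero}  _   _ = refl
divisible-by-all-powers⇒≡0 {a = suc k} 1<q divisible with divisible (suc k)
... | D , q⊥D , q^a∣Da = contradiction
  (coprime-divisor (Coprimality.sym (coprime-^ʳ (suc k) (Coprimality.sym q⊥D))) q^a∣Da)
  (>⇒∤ (n<m^n 1<q (suc k)))

record InZ₍_₎ (q : ℕ) (s : ℚ) : Set where
  constructor fraction
  field
    denominator            : ℕ
    coprime                : Coprime q denominator
    numerator              : ℤ
    *denominator≡numerator : s ℚ.* ℕ→ℚ denominator ≡ ℤ→ℚ numerator

module _ {q : ℕ} where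

  InZ₍q₎-ℤ→ℚ : ∀ a → InZ₍ q ₎ (ℤ→ℚ a)
  InZ₍q₎-ℤ→ℚ a = fraction 1 (Coprimality.sym (Coprimality.1-coprimeTo q)) a (ℚP.*-identityʳ (ℤ→ℚ a))

  InZ₍q₎-* : ∀ {s t} → InZ₍ q ₎ s → InZ₍ q ₎ t → InZ₍ q ₎ (s ℚ.* t)
  InZ₍q₎-* {s} {t} (fraction D q⊥D a sD≡a) (fraction E q⊥E b tE≡b) =
    fraction (D ℕ.* E) (coprime-*ʳ q⊥D q⊥E) (a * b) (begin
      s ℚ.* t ℚ.* ℕ→ℚ (D ℕ.* E)          ≡⟨ cong (s ℚ.* t ℚ.*_) (ℕ→ℚ-* D E) ⟩
      s ℚ.* t ℚ.* (ℕ→ℚ D ℚ.* ℕ→ℚ E)      ≡⟨ solve 4 (λ s t D E → s :* t :* (D :* E) := s :* D :* (t :* E))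
                                                     refl s t (ℕ→ℚ D) (ℕ→ℚ E) ⟩
      s ℚ.* ℕ→ℚ D ℚ.* (t ℚ.* ℕ→ℚ E)      ≡⟨ cong₂ ℚ._*_ sD≡a tE≡b ⟩
      ℤ→ℚ a ℚ.* ℤ→ℚ b                    ≡⟨ sym (ℤ→ℚ-* a b) ⟩
      ℤ→ℚ (a * b)                        ∎)
    where open ≡-Reasoning

  InZ₍q₎-sub : ∀ {s t} → InZ₍ q ₎ s → InZ₍ q ₎ t → InZ₍ q ₎ (s ℚ.+ ℚ.- t)
  InZ₍q₎-sub {s} {t} (fraction D q⊥D a sD≡a) (fraction E q⊥E b tE≡b) =
    fraction (D ℕ.* E) (coprime-*ʳ q⊥D q⊥E) (a * + E + ℤ.- (b * + D)) (begin
      (s ℚ.+ ℚ.- t) ℚ.* ℕ→ℚ (D ℕ.* E)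
        ≡⟨ cong ((s ℚ.+ ℚ.- t) ℚ.*_) (ℕ→ℚ-* D E) ⟩
      (s ℚ.+ ℚ.- t) ℚ.* (ℕ→ℚ D ℚ.* ℕ→ℚ E)
        ≡⟨ solve 4 (λ s t D E → (s :+ (:- t)) :* (D :* E) := s :* D :* E :+ (:- (t :* E :* D)))
                   refl s t (ℕ→ℚ D) (ℕ→ℚ E) ⟩
      s ℚ.* ℕ→ℚ D ℚ.* ℕ→ℚ E ℚ.+ ℚ.- (t ℚ.* ℕ→ℚ E ℚ.* ℕ→ℚ D)
        ≡⟨ cong₂ (λ u v → u ℚ.* ℕ→ℚ E ℚ.+ ℚ.- (v ℚ.* ℕ→ℚ D)) sD≡a tE≡b ⟩
      ℤ→ℚ a ℚ.* ℕ→ℚ E ℚ.+ ℚ.- (ℤ→ℚ b ℚ.* ℕ→ℚ D)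
        ≡⟨ sym (cong₂ (λ u v → u ℚ.+ ℚ.- v) (ℤ→ℚ-* a (+ E)) (ℤ→ℚ-* b (+ D))) ⟩
      ℤ→ℚ (a * + E) ℚ.+ ℚ.- ℤ→ℚ (b * + D)
        ≡⟨ cong (ℤ→ℚ (a * + E) ℚ.+_) (sym (ℤ→ℚ-neg (b * + D))) ⟩
      ℤ→ℚ (a * + E) ℚ.+ ℤ→ℚ (ℤ.- (b * + D))
        ≡⟨ sym (ℤ→ℚ-+ (a * + E) (ℤ.- (b * + D))) ⟩
      ℤ→ℚ (a * + E + ℤ.- (b * + D))
        ∎)
    where open ≡-Reasoning

  InZ[1/p,1/q]⇒InZ₍q₎ : ∀ {p₁ p₂ s} → Coprime q p₁ → Coprime q p₂ → InZ[1/p,1/q] p₁ p₂ s → InZ₍ q ₎ s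
  InZ[1/p,1/q]⇒InZ₍q₎ {p₁} {p₂} q⊥p₁ q⊥p₂ (a , m , n , eq) =
    fraction (p₁ ^ m ℕ.* p₂ ^ n) (coprime-*ʳ (coprime-^ʳ m q⊥p₁) (coprime-^ʳ n q⊥p₂)) a eq

  InZ[1/p]⇒InZ₍q₎ : ∀ {p s} → Coprime q p → InZ[1/p] p s → InZ₍ q ₎ s
  InZ[1/p]⇒InZ₍q₎ {p} q⊥p (a , m , eq) = fraction (p ^ m) (coprime-^ʳ m q⊥p) a eq

  numerator-divisible : ∀ {t D₀ a s} n → t ℚ.* ℕ→ℚ D₀ ≡ ℤ→ℚ a → InZ₍ q ₎ s → t ≡ ℕ→ℚ (q ^ n) ℚ.* s →
    ∃ λ D → Coprime q D × q ^ n ∣ D ℕ.* ℤ.∣ a ∣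
  numerator-divisible {t} {D₀} {a} {s} n tD₀≡a (fraction D q⊥D b sD≡b) t≡qⁿs =
    D , q⊥D , divides ℤ.∣ b * + D₀ ∣
      (trans (sym (ℤP.abs-* (+ D) a)) (trans (cong ℤ.∣_∣ Da≡bD₀qⁿ) (ℤP.abs-* (b * + D₀) (+ (q ^ n)))))
    where
    open ≡-Reasoning
    Da≡bD₀qⁿ : + D * a ≡ b * + D₀ * + (q ^ n)
    Da≡bD₀qⁿ = ℤ→ℚ-injective (begin
      ℤ→ℚ (+ D * a)                                  ≡⟨ ℤ→ℚ-* (+ D) a ⟩
      ℕ→ℚ D ℚ.* ℤ→ℚ a                                ≡⟨ cong (ℕ→ℚ D ℚ.*_) (sym tD₀≡a) ⟩
      ℕ→ℚ D ℚ.* (t ℚ.* ℕ→ℚ D₀)                       ≡⟨ cong (λ u → ℕ→ℚ D ℚ.* (u ℚ.* ℕ→ℚ D₀)) t≡qⁿs ⟩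
      ℕ→ℚ D ℚ.* (ℕ→ℚ (q ^ n) ℚ.* s ℚ.* ℕ→ℚ D₀)       ≡⟨ solve 4 (λ D Q s D₀ → D :* (Q :* s :* D₀) := s :* D :* D₀ :* Q)
                                                            refl (ℕ→ℚ D) (ℕ→ℚ (q ^ n)) s (ℕ→ℚ D₀) ⟩
      s ℚ.* ℕ→ℚ D ℚ.* ℕ→ℚ D₀ ℚ.* ℕ→ℚ (q ^ n)         ≡⟨ cong (λ u → u ℚ.* ℕ→ℚ D₀ ℚ.* ℕ→ℚ (q ^ n)) sD≡b ⟩
      ℤ→ℚ b ℚ.* ℕ→ℚ D₀ ℚ.* ℕ→ℚ (q ^ n)               ≡⟨ sym (trans (ℤ→ℚ-* (b * + D₀) (+ (q ^ n)))
                                                                   (cong (ℚ._* ℕ→ℚ (q ^ n)) (ℤ→ℚ-* b (+ D₀)))) ⟩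
      ℤ→ℚ (b * + D₀ * + (q ^ n))                     ∎)

  InZ₍q₎-divisible⇒≡0 : ∀ {t} → 1 < q →
    (∀ n → ∃ λ s → InZ₍ q ₎ s × t ≡ ℕ→ℚ (q ^ n) ℚ.* s) → t ≡ 0ℚ
  InZ₍q₎-divisible⇒≡0 {t} 1<q divisible with divisible 0
  ... | s₀ , fraction D₀ q⊥D₀ a s₀D₀≡a , t≡1s₀ =
    *-cancelˡ-≢0 (ℕ→ℚ D₀) (ℕ→ℚ-≢0 (coprime⇒≢0 1<q q⊥D₀)) (begin
      ℕ→ℚ D₀ ℚ.* t     ≡⟨ ℚP.*-comm (ℕ→ℚ D₀) t ⟩
      t ℚ.* ℕ→ℚ D₀     ≡⟨ tD₀≡a ⟩
      ℤ→ℚ a            ≡⟨ cong ℤ→ℚ (ℤP.∣i∣≡0⇒i≡0 {a} (divisible-by-all-powers⇒≡0 1<q a-divisible)) ⟩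
      0ℚ               ≡⟨ sym (ℚP.*-zeroʳ (ℕ→ℚ D₀)) ⟩
      ℕ→ℚ D₀ ℚ.* 0ℚ    ∎)
    where
    open ≡-Reasoning
    tD₀≡a : t ℚ.* ℕ→ℚ D₀ ≡ ℤ→ℚ a
    tD₀≡a = trans (cong (ℚ._* ℕ→ℚ D₀) (trans t≡1s₀ (ℚP.*-identityˡ s₀))) s₀D₀≡a

    a-divisible : ∀ n → ∃ λ D → Coprime q D × q ^ n ∣ D ℕ.* ℤ.∣ a ∣
    a-divisible n = let (s , s∈ , t≡qⁿs) = divisible n in numerator-divisible {D₀ = D₀} {a} n tD₀≡a s∈ t≡qⁿs

  InZ₍q₎-divisible-sequence≈0 : 1 < q → (W : ℕ → U) → (∀ β k → InZ₍ q ₎ (W β k)) →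
    (∀ β → W β ≈ ℕ→ℚ q · W (suc β)) → ∀ β → W β ≈ 0U
  InZ₍q₎-divisible-sequence≈0 1<q W W∈ W-step β k =
    InZ₍q₎-divisible⇒≡0 1<q (λ n → W (n ℕ.+ β) k , W∈ (n ℕ.+ β) k , iterated-step n)
    where
    open ≡-Reasoning
    iterated-step : ∀ n → W β k ≡ ℕ→ℚ (q ^ n) ℚ.* W (n ℕ.+ β) k
    iterated-step zero    = sym (ℚP.*-identityˡ (W β k))
    iterated-step (suc n) = begin
      W β k                                                  ≡⟨ iterated-step n ⟩
      ℕ→ℚ (q ^ n) ℚ.* W (n ℕ.+ β) k                          ≡⟨ cong (ℕ→ℚ (q ^ n) ℚ.*_) (W-step (n ℕ.+ β) k) ⟩
      ℕ→ℚ (q ^ n) ℚ.* (ℕ→ℚ q ℚ.* W (suc n ℕ.+ β) k)          ≡⟨ solve 3 (λ Q q w → Q :* (q :* w) := q :* Q :* w)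
                                                                    refl (ℕ→ℚ (q ^ n)) (ℕ→ℚ q) (W (suc n ℕ.+ β) k) ⟩
      ℕ→ℚ q ℚ.* ℕ→ℚ (q ^ n) ℚ.* W (suc n ℕ.+ β) k            ≡⟨ cong (ℚ._* W (suc n ℕ.+ β) k) (sym (ℕ→ℚ-* q (q ^ n))) ⟩
      ℕ→ℚ (q ^ suc n) ℚ.* W (suc n ℕ.+ β) k                  ∎

record IsSubgroup (S : U → Set) : Set where
  field
    ≈-closed   : ∀ {x y} → x ≈ y → S x → S y
    0-closed   : S 0U
    sub-closed : ∀ {x y} → S x → S y → S (x +U (-U y))

  ℕ-multiple-closed : ∀ n {x} → S x → S (ℕ→ℚ n · x)
  ℕ-multiple-closed zero    {x} _  = ≈-closed (λ k → sym (ℚP.*-zeroˡ (x k))) 0-closed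
  ℕ-multiple-closed (suc n) {x} Sx =
    ≈-closed (λ k → trans (solve 2 (λ n x → n :* x :+ (:- (con 0ℚ :+ (:- x))) := (con 1ℚ :+ n) :* x)
                                   refl (ℕ→ℚ n) (x k))
                          (cong (ℚ._* x k) (sym (ℕ→ℚ-suc n))))
             (sub-closed (ℕ-multiple-closed n Sx) (sub-closed 0-closed Sx))

  ℤ-multiple-closed : ∀ a {x} → S x → S (ℤ→ℚ a · x)
  ℤ-multiple-closed (+ n)    Sx = ℕ-multiple-closed n Sx
  ℤ-multiple-closed -[1+ n ] {x} Sx =
    ≈-closed (λ k → solve 2 (λ n x → con 0ℚ :+ (:- (n :* x)) := (:- n) :* x) refl (ℕ→ℚ (suc n)) (x k))
             (sub-closed 0-closed (ℕ-multiple-closed (suc n) Sx))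

open IsSubgroup

⟨⟩-isSubgroup : ∀ {G} → IsSubgroup ⟨ G ⟩
⟨⟩-isSubgroup = record { ≈-closed = resp ; 0-closed = zero ; sub-closed = sub }

⟨⟩-least : ∀ {G S} → IsSubgroup S → (∀ {x} → G x → S x) → ∀ {x} → ⟨ G ⟩ x → S x
⟨⟩-least S-subgroup G⊆S (gen Gx)          = G⊆S Gx
⟨⟩-least S-subgroup G⊆S zero              = 0-closed S-subgroup
⟨⟩-least S-subgroup G⊆S (sub ⟨G⟩x ⟨G⟩y)   =
  sub-closed S-subgroup (⟨⟩-least S-subgroup G⊆S ⟨G⟩x) (⟨⟩-least S-subgroup G⊆S ⟨G⟩y)
⟨⟩-least S-subgroup G⊆S (resp x≈y ⟨G⟩x)   = ≈-closed S-subgroup x≈y (⟨⟩-least S-subgroup G⊆S ⟨G⟩x)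

coordinatewise-isSubgroup : (R : ℚ → Set) → R 0ℚ → (∀ {s t} → R s → R t → R (s ℚ.+ ℚ.- t)) →
  IsSubgroup (λ x → ∀ k → R (x k))
coordinatewise-isSubgroup R R0 R-sub = record
  { ≈-closed   = λ x≈y Rx k → subst R (x≈y k) (Rx k)
  ; 0-closed   = λ _ → R0
  ; sub-closed = λ Rx Ry k → R-sub (Rx k) (Ry k)
  }

InZ₍q₎-if : ∀ {q} b {s t} → InZ₍ q ₎ s → InZ₍ q ₎ t → InZ₍ q ₎ (if b then s else t)
InZ₍q₎-if true  s∈ _  = s∈
InZ₍q₎-if false _  t∈ = t∈

e-InZ₍q₎ : ∀ {q} α k → InZ₍ q ₎ (e α k)
e-InZ₍q₎ α k = InZ₍q₎-if (does (k ℕ.≟ α)) (InZ₍q₎-ℤ→ℚ (+ 1)) (InZ₍q₎-ℤ→ℚ (+ 0))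

tailSeq-InZ₍q₎ : ∀ {q} c q′ α k → InZ₍ q ₎ (tailSeq c q′ α k)
tailSeq-InZ₍q₎ c q′ α k = InZ₍q₎-if (k ℕ.<ᵇ α) (InZ₍q₎-ℤ→ℚ (+ 0)) (InZ₍q₎-ℤ→ℚ (c k * + (q′ ^ (k ℕ.∸ α))))

module ElementsOfN (p₁ p₂ q₁ q₂ : ℕ) (c d : ℕ → ℤ) where

  e∈N : ∀ α → InN p₁ p₂ q₁ q₂ c d (e α)
  e∈N α = gen (inj₁ (gen (α , 1ℚ , (+ 1 , 0 , 0 , refl) , λ k → sym (ℚP.*-identityˡ (e α k)))))

  y∈N : ∀ β → InN p₁ p₂ q₁ q₂ c d (tailSeq c q₁ β)
  y∈N β = gen (inj₂ (inj₁ (β , 1ℚ , (+ 1 , 0 , refl) , λ k → sym (ℚP.*-identityˡ _))))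

  z∈N : ∀ β → InN p₁ p₂ q₁ q₂ c d (tailSeq d q₂ β)
  z∈N β = gen (inj₂ (inj₂ (β , 1ℚ , (+ 1 , 0 , refl) , λ k → sym (ℚP.*-identityˡ _))))

  InN⇒InZ₍q₎ : ∀ {q} → Coprime q p₁ → Coprime q p₂ → ∀ {x} → InN p₁ p₂ q₁ q₂ c d x → ∀ k → InZ₍ q ₎ (x k)
  InN⇒InZ₍q₎ {q} q⊥p₁ q⊥p₂ = ⟨⟩-least coordinates λ
    { (inj₁ x∈M) → ⟨⟩-least coordinates
        (λ (α , r , r∈ , x≈) → multiple r (e α) (InZ[1/p,1/q]⇒InZ₍q₎ q⊥p₁ q⊥p₂ r∈) (e-InZ₍q₎ α) x≈) x∈M
    ; (inj₂ (inj₁ (α , r , r∈ , x≈))) →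
        multiple r (tailSeq c q₁ α) (InZ[1/p]⇒InZ₍q₎ q⊥p₂ r∈) (tailSeq-InZ₍q₎ c q₁ α) x≈
    ; (inj₂ (inj₂ (α , r , r∈ , x≈))) →
        multiple r (tailSeq d q₂ α) (InZ[1/p]⇒InZ₍q₎ q⊥p₂ r∈) (tailSeq-InZ₍q₎ d q₂ α) x≈
    }
    where
    coordinates : IsSubgroup (λ x → ∀ k → InZ₍ q ₎ (x k))
    coordinates = coordinatewise-isSubgroup InZ₍ q ₎ (InZ₍q₎-ℤ→ℚ (+ 0)) InZ₍q₎-sub

    multiple : ∀ {x} r g → InZ₍ q ₎ r → (∀ k → InZ₍ q ₎ (g k)) → x ≈ r · g → ∀ k → InZ₍ q ₎ (x k)
    multiple _ _ r∈ g∈ x≈rg k = subst InZ₍ q ₎ (sym (x≈rg k)) (InZ₍q₎-* r∈ (g∈ k))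

tailSeq-step : ∀ c q β → tailSeq c q β ≈ (ℤ→ℚ (c β) · e β) +U (ℕ→ℚ q · tailSeq c q (suc β))
tailSeq-step c q zero    zero    =
  trans (cong ℤ→ℚ (ℤP.*-identityʳ (c 0)))
        (solve 2 (λ c q → c := c :* con 1ℚ :+ q :* con 0ℚ) refl (ℤ→ℚ (c 0)) (ℕ→ℚ q))
tailSeq-step c q zero    (suc k) = begin
  ℤ→ℚ (c (suc k) * + (q ℕ.* q ^ k))      ≡⟨ cong ℤ→ℚ (trans (cong (c (suc k) *_) (ℤP.pos-* q (q ^ k)))
                                                           (ℤ*.x∙yz≈y∙xz (c (suc k)) (+ q) (+ (q ^ k)))) ⟩
  ℤ→ℚ (+ q * (c (suc k) * + (q ^ k)))    ≡⟨ ℤ→ℚ-* (+ q) (c (suc k) * + (q ^ k)) ⟩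
  ℕ→ℚ q ℚ.* ℤ→ℚ (c (suc k) * + (q ^ k))  ≡⟨ sym (trans (cong (ℚ._+ qcQ) (ℚP.*-zeroʳ (ℤ→ℚ (c 0)))) (ℚP.+-identityˡ qcQ)) ⟩
  ℤ→ℚ (c 0) ℚ.* 0ℚ ℚ.+ ℕ→ℚ q ℚ.* ℤ→ℚ (c (suc k) * + (q ^ k)) ∎
  where
  open ≡-Reasoning
  qcQ : ℚ
  qcQ = ℕ→ℚ q ℚ.* ℤ→ℚ (c (suc k) * + (q ^ k))
tailSeq-step c q (suc β) zero    =
  solve 2 (λ c q → con 0ℚ := c :* con 0ℚ :+ q :* con 0ℚ) refl (ℤ→ℚ (c (suc β))) (ℕ→ℚ q)
-- Shifting both indices by one amounts to shifting the sequence c.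
tailSeq-step c q (suc β) (suc k) = tailSeq-step (c ∘ suc) q β k

module Endomorphism {G : U → Set} (φ : EndoHom ⟨ G ⟩) where
  open EndoHom φ

  f-sub : ∀ {x y} (hx : ⟨ G ⟩ x) (hy : ⟨ G ⟩ y) h → f (x +U (-U y)) h ≈ f x hx +U (-U f y hy)
  f-sub {x} {y} hx hy h k =
    x≡y+z⇒y≡x-z (trans (f-cong x (x-y +U y) hx hx-y+y x≈x-y+y k) (f-add x-y y h hy hx-y+y k))
    where
    x-y : U
    x-y = x +U (-U y)
    x≈x-y+y : x ≈ x-y +U y
    x≈x-y+y k = solve 2 (λ x y → x := x :+ (:- y) :+ y) refl (x k) (y k)
    hx-y+y : ⟨ G ⟩ (x-y +U y)
    hx-y+y = resp x≈x-y+y hx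

  f-0 : ∀ h → f 0U h ≈ 0U
  f-0 h k = trans (f-cong 0U (0U +U (-U 0U)) h h0-0 (λ _ → refl) k)
                  (trans (f-sub h h h0-0 k) (ℚP.+-inverseʳ (f 0U h k)))
    where
    h0-0 : ⟨ G ⟩ (0U +U (-U 0U))
    h0-0 = sub zero zero

  f-ℕ-multiple : ∀ n {x} (hx : ⟨ G ⟩ x) h → f (ℕ→ℚ n · x) h ≈ ℕ→ℚ n · f x hx
  f-ℕ-multiple zero    {x} hx h k =
    trans (f-cong _ 0U h zero (λ k → ℚP.*-zeroˡ (x k)) k) (trans (f-0 zero k) (sym (ℚP.*-zeroˡ (f x hx k))))
  f-ℕ-multiple (suc n) {x} hx h k = begin
    f (ℕ→ℚ (suc n) · x) h k                 ≡⟨ f-cong _ (nx +U x) h hnx+x [1+n]x≈nx+x k ⟩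
    f (nx +U x) hnx+x k                      ≡⟨ f-add nx x hnx hx hnx+x k ⟩
    f nx hnx k ℚ.+ f x hx k                  ≡⟨ cong (ℚ._+ f x hx k) (f-ℕ-multiple n hx hnx k) ⟩
    ℕ→ℚ n ℚ.* f x hx k ℚ.+ f x hx k          ≡⟨ sym ([1+n]x≡nx+x (f x hx k)) ⟩
    ℕ→ℚ (suc n) ℚ.* f x hx k                 ∎
    where
    open ≡-Reasoning
    nx : U
    nx = ℕ→ℚ n · x
    hnx : ⟨ G ⟩ nx
    hnx = ℕ-multiple-closed ⟨⟩-isSubgroup n hx
    [1+n]x≡nx+x : ∀ y → ℕ→ℚ (suc n) ℚ.* y ≡ ℕ→ℚ n ℚ.* y ℚ.+ y
    [1+n]x≡nx+x y = trans (cong (ℚ._* y) (ℕ→ℚ-suc n))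
                         (solve 2 (λ n y → (con 1ℚ :+ n) :* y := n :* y :+ y) refl (ℕ→ℚ n) y)
    [1+n]x≈nx+x : ℕ→ℚ (suc n) · x ≈ nx +U x
    [1+n]x≈nx+x k = [1+n]x≡nx+x (x k)
    hnx+x : ⟨ G ⟩ (nx +U x)
    hnx+x = resp [1+n]x≈nx+x h

  Fixed : U → Set
  Fixed x = ⟨ G ⟩ x × (∀ h → f x h ≈ x)

  Fixed-isSubgroup : IsSubgroup Fixed
  Fixed-isSubgroup = record
    { ≈-closed   = λ {x} {y} x≈y (hx , fx) →
        resp x≈y hx , λ h k → trans (f-cong y x h hx (sym ∘ x≈y) k) (trans (fx hx k) (x≈y k))
    ; 0-closed   = zero , f-0
    ; sub-closed = λ (hx , fx) (hy , fy) →
        sub hx hy , λ h k → trans (f-sub hx hy h k) (cong₂ (λ u v → u ℚ.+ ℚ.- v) (fx hx k) (fy hy k))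
    }

  -- (↧ r) · x = (↥ r) · g is fixed, and U is torsion-free.
  Fixed-ℚ-multiple : ∀ r {g x} → Fixed g → ⟨ G ⟩ x → x ≈ r · g → Fixed x
  Fixed-ℚ-multiple r {g} {x} g-fixed hx x≈rg =
    hx , λ h k → *-cancelˡ-≢0 (ℕ→ℚ D) (ℕ→ℚ-≢0 {D} λ ())
                   (trans (sym (f-ℕ-multiple D h hDx k)) (proj₂ Dx-fixed hDx k))
    where
    D : ℕ
    D = ℚ.↧ₙ r
    hDx : ⟨ G ⟩ (ℕ→ℚ D · x)
    hDx = ℕ-multiple-closed ⟨⟩-isSubgroup D hx
    ↥r·g≈Dx : ℤ→ℚ (ℚ.↥ r) · g ≈ ℕ→ℚ D · x
    ↥r·g≈Dx k = begin
      ℤ→ℚ (ℚ.↥ r) ℚ.* g k           ≡⟨ cong (ℚ._* g k) (sym (*-denominator r)) ⟩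
      r ℚ.* ℕ→ℚ D ℚ.* g k           ≡⟨ solve 3 (λ r D g → r :* D :* g := D :* (r :* g)) refl r (ℕ→ℚ D) (g k) ⟩
      ℕ→ℚ D ℚ.* (r ℚ.* g k)         ≡⟨ cong (ℕ→ℚ D ℚ.*_) (sym (x≈rg k)) ⟩
      ℕ→ℚ D ℚ.* x k                 ∎
      where open ≡-Reasoning
    Dx-fixed : Fixed (ℕ→ℚ D · x)
    Dx-fixed = ≈-closed Fixed-isSubgroup ↥r·g≈Dx (ℤ-multiple-closed Fixed-isSubgroup (ℚ.↥ r) g-fixed)

  module _ (c : ℕ → ℤ) {q} (1<q : 1 < q) (e-fixed : ∀ α → Fixed (e α))
           (tailSeq∈ : ∀ β → ⟨ G ⟩ (tailSeq c q β))
           (⟨G⟩⇒InZ₍q₎ : ∀ {x} → ⟨ G ⟩ x → ∀ k → InZ₍ q ₎ (x k)) where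

    private
      Y : ℕ → U
      Y = tailSeq c q

      defect : ℕ → U
      defect β = f (Y β) (tailSeq∈ β) +U (-U Y β)

      defect-step : ∀ β → defect β ≈ ℕ→ℚ q · defect (suc β)
      defect-step β k = begin
        f (Y β) hY k ℚ.+ ℚ.- Y β k                               ≡⟨ cong₂ (λ u v → u ℚ.+ ℚ.- v) f[Yβ] (tailSeq-step c q β k) ⟩
        ce k ℚ.+ ℕ→ℚ q ℚ.* f (Y (suc β)) hY′ k ℚ.+ ℚ.- (ce k ℚ.+ ℕ→ℚ q ℚ.* Y (suc β) k)
                                                                  ≡⟨ solve 4 (λ a q y z → a :+ q :* y :+ (:- (a :+ q :* z))
                                                                                          := q :* (y :+ (:- z)))
                                                                       refl (ce k) (ℕ→ℚ q) (f (Y (suc β)) hY′ k) (Y (suc β) k) ⟩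
        ℕ→ℚ q ℚ.* defect (suc β) k                                ∎
        where
        open ≡-Reasoning
        hY : ⟨ G ⟩ (Y β)
        hY = tailSeq∈ β
        hY′ : ⟨ G ⟩ (Y (suc β))
        hY′ = tailSeq∈ (suc β)
        ce qY′ : U
        ce = ℤ→ℚ (c β) · e β
        qY′ = ℕ→ℚ q · Y (suc β)
        ce-fixed : Fixed ce
        ce-fixed = ℤ-multiple-closed Fixed-isSubgroup (c β) (e-fixed β)
        hqY′ : ⟨ G ⟩ qY′
        hqY′ = ℕ-multiple-closed ⟨⟩-isSubgroup q hY′
        hce+qY′ : ⟨ G ⟩ (ce +U qY′)
        hce+qY′ = resp (tailSeq-step c q β) hY
        f[Yβ] : f (Y β) hY k ≡ ce k ℚ.+ ℕ→ℚ q ℚ.* f (Y (suc β)) hY′ k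
        f[Yβ] = begin
          f (Y β) hY k                                    ≡⟨ f-cong _ _ hY hce+qY′ (tailSeq-step c q β) k ⟩
          f (ce +U qY′) hce+qY′ k                         ≡⟨ f-add ce qY′ (proj₁ ce-fixed) hqY′ hce+qY′ k ⟩
          f ce (proj₁ ce-fixed) k ℚ.+ f qY′ hqY′ k        ≡⟨ cong₂ ℚ._+_ (proj₂ ce-fixed (proj₁ ce-fixed) k)
                                                                        (f-ℕ-multiple q hY′ hqY′ k) ⟩
          ce k ℚ.+ ℕ→ℚ q ℚ.* f (Y (suc β)) hY′ k          ∎

      defect≈0 : ∀ β → defect β ≈ 0U
      defect≈0 = InZ₍q₎-divisible-sequence≈0 1<q defect
        (λ β → ⟨G⟩⇒InZ₍q₎ (sub (f-in (Y β) (tailSeq∈ β)) (tailSeq∈ β))) defect-step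

    tailSeq-fixed : ∀ β → Fixed (tailSeq c q β)
    tailSeq-fixed β = tailSeq∈ β , λ h k →
      trans (f-cong (Y β) (Y β) h (tailSeq∈ β) (λ _ → refl) k) (x-y≡0⇒x≡y (defect≈0 β k))

theorem3p12 : (p₁ p₂ q₁ q₂ : ℕ) →
    Prime p₁ → Prime p₂ → Prime q₁ → Prime q₂ →
    p₁ ≢ p₂ → p₁ ≢ q₁ → p₁ ≢ q₂ → p₂ ≢ q₁ → p₂ ≢ q₂ → q₁ ≢ q₂ →
    (c d : ℕ → ℤ) →
    (∀ α → c α * (+ (q₁ ℕ.^ α)) + d α * (+ (q₂ ℕ.^ α)) ≡ + 1) →
    (φ : EndoHom (InN p₁ p₂ q₁ q₂ c d)) →
    (∀ α (h : InN p₁ p₂ q₁ q₂ c d (e α)) → EndoHom.f φ (e α) h ≈ e α) →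
    ∀ x (h : InN p₁ p₂ q₁ q₂ c d x) → EndoHom.f φ x h ≈ x
theorem3p12 p₁ p₂ q₁ q₂ p₁-prime p₂-prime q₁-prime q₂-prime _ p₁≢q₁ p₁≢q₂ p₂≢q₁ p₂≢q₂ _ c d _ φ f[e]≈e x x∈N =
  proj₂ (⟨⟩-least Fixed-isSubgroup generator-fixed x∈N) x∈N
  where
  open Endomorphism φ
  open ElementsOfN p₁ p₂ q₁ q₂ c d

  prime>1 : ∀ {q} → Prime q → 1 < q
  prime>1 q-prime = ℕ.nonTrivial⇒n>1 _ {{prime⇒nonTrivial q-prime}}

  coprime : ∀ {p q} → Prime p → Prime q → p ≢ q → Coprime q p
  coprime p-prime q-prime p≢q = distinct-primes-coprime q-prime p-prime (p≢q ∘ sym)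

  e-fixed : ∀ α → Fixed (e α)
  e-fixed α = e∈N α , f[e]≈e α

  y-fixed : ∀ β → Fixed (tailSeq c q₁ β)
  y-fixed = tailSeq-fixed c (prime>1 q₁-prime) e-fixed y∈N
    (InN⇒InZ₍q₎ (coprime p₁-prime q₁-prime p₁≢q₁) (coprime p₂-prime q₁-prime p₂≢q₁))

  z-fixed : ∀ β → Fixed (tailSeq d q₂ β)
  z-fixed = tailSeq-fixed d (prime>1 q₂-prime) e-fixed z∈N
    (InN⇒InZ₍q₎ (coprime p₁-prime q₂-prime p₁≢q₂) (coprime p₂-prime q₂-prime p₂≢q₂))

  generator-fixed : ∀ {x} → N-gens p₁ p₂ q₁ q₂ c d x → Fixed x
  generator-fixed (inj₁ x∈M) = ⟨⟩-least Fixed-isSubgroup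
    (λ g@(α , r , _ , x≈re) → Fixed-ℚ-multiple r (e-fixed α) (gen (inj₁ (gen g))) x≈re) x∈M
  generator-fixed g@(inj₂ (inj₁ (β , r , _ , x≈ry))) = Fixed-ℚ-multiple r (y-fixed β) (gen g) x≈ry
  generator-fixed g@(inj₂ (inj₂ (β , r , _ , x≈rz))) = Fixed-ℚ-multiple r (z-fixed β) (gen g) x≈rz
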